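{- Let $S$ be as in the context. For $1\le i\le n-1$: $\mathbf{s_i}\overline i=\overline{i+1}$, $\mathbf{s_i}\overline{i+1}=\overline i$, and $\mathbf{s_i}$ fixes every vector in $\Pi\setminus\{\overline i,\overline{i+1}\}$.
   Context: $S$ is a finite simple connected graph with vertex set $\{s_1,\dots,s_n\}$, $n\ge2$, and edge set $R$, such that $s_1,\dots,s_{n-1}$ is an induced path; $s_n$ is adjacent to some of $s_1,\dots,s_{n-1}$. $\widetilde s$ is the characteristic vector in $F_2^n$ (coordinates indexed by vertices) of vertex $s$. The flipping move of $s$ is $\mathbf s\in\mathrm{Mat}_n(F_2)$ with $\mathbf s_{ab}=1$ if $a=b$, or if $b=s$ and $ab\in R$, and $0$ otherwise. $\overline1=\widetilde s_1$, $\overline{i+1}=\mathbf{s_i}\cdots\mathbf{s_1}\overline1$ for $1\le i\le n-1$, and $\Pi=\{\overline1,\dots,\overline n\}$. -}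

module Defs where

open import Data.Bool using (Bool; true; false; _∧_; _∨_; _xor_)
open import Data.Nat using (ℕ; zero; suc; _<_; z<s)
open import Data.Nat.Properties using (<-trans; n<1+n)
open import Data.Fin using (Fin; toℕ; fromℕ<; _≟_)
open import Data.Fin.Properties using (toℕ<n)
open import Data.List using (foldr; map)
open import Data.List using () renaming ([] to [])
open import Data.Vec.Functional using (Vector)
open import Data.Vec using (allFin; toList)
open import Data.Product using (Σ; _×_)
open import Data.Sum using (_⊎_)
open import Relation.Binary.PropositionalEquality using (_≡_)
open import Relation.Nullary.Decidable using (⌊_⌋)

-- Vectors in F₂ⁿ (F₂ = Bool, addition = xor, multiplication = ∧)
-- and n×n matrices over F₂, indexed by Fin n.
F2Vec : ℕ → Set
F2Vec n = Fin n → Bool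

F2Mat : ℕ → Set
F2Mat n = Fin n → Fin n → Bool

Σ₂ : ∀ {n} → (Fin n → Bool) → Bool
Σ₂ {n} f = foldr _xor_ false (map f (toList (allFin n)))

_·_ : ∀ {n} → F2Mat n → F2Vec n → F2Vec n
(M · v) a = Σ₂ (λ b → M a b ∧ v b)

_≈_ : ∀ {n} → F2Vec n → F2Vec n → Set
u ≈ v = ∀ a → u a ≡ v a

record SimpleGraph (n : ℕ) : Set where
  field
    adj   : Fin n → Fin n → Bool
    sym   : ∀ a b → adj a b ≡ adj b a
    irrefl : ∀ a → adj a a ≡ false

open SimpleGraph public

chr : ∀ {n} → Fin n → F2Vec n
chr s a = ⌊ a ≟ s ⌋

flipMove : ∀ {n} → SimpleGraph n → Fin n → F2Mat n
flipMove G s a b = ⌊ a ≟ b ⌋ ∨ (⌊ b ≟ s ⌋ ∧ adj G a b)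

-- \overline{k+1} (0-based k): \overline 1 = chr s_1, \overline{k+2} = s_{k+1} \overline{k+1}
barℕ : ∀ {n} → SimpleGraph n → (k : ℕ) → k < n → F2Vec n
barℕ G zero p = chr (fromℕ< p)
barℕ G (suc k) p =
  let q = <-trans (n<1+n k) p in
  flipMove G (fromℕ< q) · barℕ G k q

-- \overline{i+1} for the 0-based vertex index i : Fin n
bar : ∀ {n} → SimpleGraph n → Fin n → F2Vec n
bar G i = barℕ G (toℕ i) (toℕ<n i)

module Submission where

-- A flipping move acts by v ↦ v + v_s · N(s), where N(s) is the neighbourhood
-- of s. As s ∉ N(s), it fixes every v with v_s = 0 and is an involution. The
-- first two claims follow, since \overline{j+1} = s_j \overline j by definition.
-- For the third, induction along the path shows that on the path coordinates
-- \overline{k+1} = e_{s_k} + e_{s_{k+1}} (just e_{s_1} for k = 0), so the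
-- s_j-coordinate of \overline l vanishes unless l ∈ {j, j+1}.

open import Defs hiding (sym)
open import Algebra.Bundles using (CommutativeRing)
open import Data.Bool using (Bool; true; false; _∧_; _xor_)
open import Data.Bool.Properties
  using (xor-∧-commutativeRing; xor-assoc; xor-same; xor-identityʳ;
         ∧-identityʳ; ∧-zeroʳ; ∧-distribʳ-xor; ¬-not)
open import Data.Fin using (Fin; zero; suc; toℕ; inject₁; fromℕ; _≟_)
open import Data.Fin.Properties using (toℕ-inject₁; toℕ-injective; toℕ-fromℕ<)
  renaming (suc-injective to Fin-suc-injective)
open import Data.List using (foldr; map)
open import Data.Nat using (ℕ; zero; suc; _<_)
open import Data.Nat.Properties using (<-irrelevant; suc-injective)
open import Data.Product using (Σ; _×_; _,_)
open import Data.Sum using (_⊎_; inj₁; inj₂; [_,_])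
import Data.Sum as Sum
open import Data.Vec using (tabulate; toList)
open import Function using (_∘_; id)
open import Relation.Binary.PropositionalEquality
  using (_≡_; _≢_; refl; sym; trans; cong; cong₂; cong-app; module ≡-Reasoning)
open import Relation.Nullary using (¬_; yes; no)
open import Relation.Nullary.Decidable using (Dec; ⌊_⌋; isYes≗does; dec-true; dec-false)

open CommutativeRing xor-∧-commutativeRing using (+-commutativeMonoid)
open import Algebra.Properties.CommutativeMonoid.Sum +-commutativeMonoid
  using (sum; sum-cong-≗; sum-replicate-zero; ∑-distrib-+)
open ≡-Reasoning

foldr-xor-tabulate : ∀ {n N} (g : Fin n → Fin N) (f : F2Vec N) →
                     foldr _xor_ false (map f (toList (tabulate g))) ≡ sum (f ∘ g)
foldr-xor-tabulate {zero}  g f = refl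
foldr-xor-tabulate {suc n} g f = cong (f (g zero) xor_) (foldr-xor-tabulate (g ∘ suc) f)

Σ₂≡sum : ∀ {n} (f : F2Vec n) → Σ₂ f ≡ sum f
Σ₂≡sum = foldr-xor-tabulate id

sum-supportedAt : ∀ {n} (c : Fin n) (f : F2Vec n) →
                  (∀ b → b ≢ c → f b ≡ false) → sum f ≡ f c
sum-supportedAt {suc n} zero f vanish = begin
  f zero xor sum (f ∘ suc) ≡⟨ cong (f zero xor_) sum-tail≡0 ⟩
  f zero xor false         ≡⟨ xor-identityʳ (f zero) ⟩
  f zero                   ∎
  where
  sum-tail≡0 : sum (f ∘ suc) ≡ false
  sum-tail≡0 = trans (sum-cong-≗ (λ b → vanish (suc b) λ ())) (sum-replicate-zero n)
sum-supportedAt (suc c) f vanish = begin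
  f zero xor sum (f ∘ suc) ≡⟨ cong (_xor sum (f ∘ suc)) (vanish zero λ ()) ⟩
  sum (f ∘ suc)            ≡⟨ sum-supportedAt c (f ∘ suc) vanish-tail ⟩
  f (suc c)                ∎
  where
  vanish-tail : ∀ b → b ≢ c → f (suc b) ≡ false
  vanish-tail b b≢c = vanish (suc b) (b≢c ∘ Fin-suc-injective)

⌊⌋-true : ∀ {p} {P : Set p} (P? : Dec P) → P → ⌊ P? ⌋ ≡ true
⌊⌋-true P? p = trans (isYes≗does P?) (dec-true P? p)

⌊⌋-false : ∀ {p} {P : Set p} (P? : Dec P) → ¬ P → ⌊ P? ⌋ ≡ false
⌊⌋-false P? ¬p = trans (isYes≗does P?) (dec-false P? ¬p)

module _ {n : ℕ} (G : SimpleGraph n) (s : Fin n) where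

  -- The disjuncts of flipMove are exclusive because G has no loops.
  flipMove-entry : ∀ a b → flipMove G s a b ≡ ⌊ a ≟ b ⌋ xor (⌊ b ≟ s ⌋ ∧ adj G a b)
  flipMove-entry a b with a ≟ b
  ... | no _     = refl
  ... | yes refl rewrite irrefl G a | ∧-zeroʳ ⌊ a ≟ s ⌋ = refl

  flipMove-· : ∀ v a → (flipMove G s · v) a ≡ v a xor (adj G a s ∧ v s)
  flipMove-· v a = begin
    (flipMove G s · v) a
      ≡⟨ Σ₂≡sum (λ b → flipMove G s a b ∧ v b) ⟩
    sum (λ b → flipMove G s a b ∧ v b)
      ≡⟨ sum-cong-≗ (λ b → trans (cong (_∧ v b) (flipMove-entry a b)) (∧-distribʳ-xor (v b) ⌊ a ≟ b ⌋ (⌊ b ≟ s ⌋ ∧ adj G a b))) ⟩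
    sum (λ b → (⌊ a ≟ b ⌋ ∧ v b) xor ((⌊ b ≟ s ⌋ ∧ adj G a b) ∧ v b))
      ≡⟨ ∑-distrib-+ (λ b → ⌊ a ≟ b ⌋ ∧ v b) (λ b → (⌊ b ≟ s ⌋ ∧ adj G a b) ∧ v b) ⟩
    sum (λ b → ⌊ a ≟ b ⌋ ∧ v b) xor sum (λ b → (⌊ b ≟ s ⌋ ∧ adj G a b) ∧ v b)
      ≡⟨ cong₂ _xor_ (sum-supportedAt a _ diagonal) (sum-supportedAt s _ column) ⟩
    (⌊ a ≟ a ⌋ ∧ v a) xor ((⌊ s ≟ s ⌋ ∧ adj G a s) ∧ v s)
      ≡⟨ cong₂ (λ x y → (x ∧ v a) xor ((y ∧ adj G a s) ∧ v s))
               (⌊⌋-true (a ≟ a) refl) (⌊⌋-true (s ≟ s) refl) ⟩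
    v a xor (adj G a s ∧ v s)
      ∎
    where
    diagonal : ∀ b → b ≢ a → ⌊ a ≟ b ⌋ ∧ v b ≡ false
    diagonal b b≢a = cong (_∧ v b) (⌊⌋-false (a ≟ b) (b≢a ∘ sym))
    column : ∀ b → b ≢ s → (⌊ b ≟ s ⌋ ∧ adj G a b) ∧ v b ≡ false
    column b b≢s = cong (λ x → (x ∧ adj G a b) ∧ v b) (⌊⌋-false (b ≟ s) b≢s)

  flipMove-fixes : ∀ v → v s ≡ false → (flipMove G s · v) ≈ v
  flipMove-fixes v vₛ≡0 a = begin
    (flipMove G s · v) a      ≡⟨ flipMove-· v a ⟩
    v a xor (adj G a s ∧ v s) ≡⟨ cong (λ x → v a xor (adj G a s ∧ x)) vₛ≡0 ⟩
    v a xor (adj G a s ∧ false) ≡⟨ cong (v a xor_) (∧-zeroʳ (adj G a s)) ⟩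
    v a xor false             ≡⟨ xor-identityʳ (v a) ⟩
    v a                       ∎

  flipMove-·-self : ∀ v → (flipMove G s · v) s ≡ v s
  flipMove-·-self v = trans (flipMove-· v s)
    (trans (cong (λ x → v s xor (x ∧ v s)) (irrefl G s)) (xor-identityʳ (v s)))

  flipMove-involutive : ∀ v → (flipMove G s · (flipMove G s · v)) ≈ v
  flipMove-involutive v a = begin
    (flipMove G s · (flipMove G s · v)) a
      ≡⟨ flipMove-· (flipMove G s · v) a ⟩
    (flipMove G s · v) a xor (adj G a s ∧ (flipMove G s · v) s)
      ≡⟨ cong₂ (λ x y → x xor (adj G a s ∧ y)) (flipMove-· v a) (flipMove-·-self v) ⟩
    (v a xor (adj G a s ∧ v s)) xor (adj G a s ∧ v s)
      ≡⟨ xor-assoc (v a) (adj G a s ∧ v s) (adj G a s ∧ v s) ⟩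
    v a xor ((adj G a s ∧ v s) xor (adj G a s ∧ v s))
      ≡⟨ cong (v a xor_) (xor-same (adj G a s ∧ v s)) ⟩
    v a xor false
      ≡⟨ xor-identityʳ (v a) ⟩
    v a
      ∎

barℕ-cong : ∀ {n} (G : SimpleGraph n) {k k′} (k<n : k < n) (k′<n : k′ < n) →
            k ≡ k′ → barℕ G k k<n ≡ barℕ G k′ k′<n
barℕ-cong G k<n k′<n refl = cong (barℕ G _) (<-irrelevant k<n k′<n)

bar-suc : ∀ {n} (G : SimpleGraph (suc n)) (j : Fin n) →
          bar G (suc j) ≡ flipMove G (inject₁ j) · bar G (inject₁ j)
bar-suc G j = cong₂ (λ s v → flipMove G s · v)
  (toℕ-injective (trans (toℕ-fromℕ< _) (sym (toℕ-inject₁ j))))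
  (barℕ-cong G _ _ (sym (toℕ-inject₁ j)))

-- Here and in pathRoot the (suc, suc) clause comes before the (suc zero, zero)
-- one, so that it holds definitionally.
consecutive : ℕ → ℕ → Bool
consecutive zero       (suc zero) = true
consecutive (suc a)    (suc b)    = consecutive a b
consecutive (suc zero) zero       = true
consecutive _          _          = false

consecutive-sound : ∀ a b → consecutive a b ≡ true → a ≡ suc b ⊎ b ≡ suc a
consecutive-sound zero          (suc zero)    _ = inj₂ refl
consecutive-sound (suc zero)    zero          _ = inj₁ refl
consecutive-sound (suc a)       (suc b)       h = Sum.map (cong suc) (cong suc) (consecutive-sound a b h)
consecutive-sound zero          zero          ()
consecutive-sound zero          (suc (suc b)) ()
consecutive-sound (suc (suc a)) zero          ()

consecutive-complete : ∀ a b → a ≡ suc b ⊎ b ≡ suc a → consecutive a b ≡ true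
consecutive-complete zero       (suc zero) _ = refl
consecutive-complete (suc zero) zero       _ = refl
consecutive-complete (suc a)    (suc b)    h =
  consecutive-complete a b (Sum.map suc-injective suc-injective h)
consecutive-complete zero          zero          (inj₁ ())
consecutive-complete zero          zero          (inj₂ ())
consecutive-complete zero          (suc (suc b)) (inj₂ ())
consecutive-complete (suc (suc a)) zero          (inj₁ ())

-- pathRoot k p holds iff p ∈ {k ∸ 1, k}: the path part of \overline{k+1}, 0-based.
pathRoot : ℕ → ℕ → Bool
pathRoot zero       zero    = true
pathRoot (suc k)    (suc p) = pathRoot k p
pathRoot (suc zero) zero    = true
pathRoot _          _       = false

-- Over F₂, {k, k+1} = {k-1, k} + {k-1, k+1}.
pathRoot-suc : ∀ k p → pathRoot (suc k) p ≡ pathRoot k p xor consecutive p k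
pathRoot-suc zero          zero          = refl
pathRoot-suc zero          (suc zero)    = refl
pathRoot-suc zero          (suc (suc p)) = refl
pathRoot-suc (suc zero)    zero          = refl
pathRoot-suc (suc (suc k)) zero          = refl
pathRoot-suc (suc k)       (suc p)       = pathRoot-suc k p

pathRoot-self : ∀ k → pathRoot k k ≡ true
pathRoot-self zero    = refl
pathRoot-self (suc k) = pathRoot-self k

pathRoot-sound : ∀ k p → pathRoot k p ≡ true → p ≡ k ⊎ suc p ≡ k
pathRoot-sound zero          zero    _ = inj₁ refl
pathRoot-sound (suc zero)    zero    _ = inj₂ refl
pathRoot-sound (suc k)       (suc p) h = Sum.map (cong suc) (cong suc) (pathRoot-sound k p h)
pathRoot-sound zero          (suc p) ()
pathRoot-sound (suc (suc k)) zero    ()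

true⇔true⇒≡ : ∀ {x y : Bool} → (x ≡ true → y ≡ true) → (y ≡ true → x ≡ true) → x ≡ y
true⇔true⇒≡ {true}  {true}  _ _ = refl
true⇔true⇒≡ {true}  {false} f _ = sym (f refl)
true⇔true⇒≡ {false} {true}  _ g = g refl
true⇔true⇒≡ {false} {false} _ _ = refl

module InducedPath {n : ℕ} (G : SimpleGraph (suc n))
  (adj⇒consecutive : ∀ (a b : Fin n) → adj G (inject₁ a) (inject₁ b) ≡ true →
                     toℕ a ≡ suc (toℕ b) ⊎ toℕ b ≡ suc (toℕ a))
  (consecutive⇒adj : ∀ (a b : Fin n) → toℕ a ≡ suc (toℕ b) ⊎ toℕ b ≡ suc (toℕ a) →
                     adj G (inject₁ a) (inject₁ b) ≡ true)
  where

  adj-path : ∀ a b → adj G (inject₁ a) (inject₁ b) ≡ consecutive (toℕ a) (toℕ b)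
  adj-path a b = true⇔true⇒≡
    (consecutive-complete _ _ ∘ adj⇒consecutive a b)
    (consecutive⇒adj a b ∘ consecutive-sound _ _)

  -- Stated through k = toℕ l so that the recursion is structural.
  bar-path : ∀ k (l : Fin (suc n)) → toℕ l ≡ k →
             ∀ p → bar G l (inject₁ p) ≡ pathRoot k (toℕ p)
  bar-path zero    zero    _   zero    = refl
  bar-path zero    zero    _   (suc p) = refl
  bar-path (suc k) (suc l) l≡k p = begin
    bar G (suc l) (inject₁ p)
      ≡⟨ cong-app (bar-suc G l) (inject₁ p) ⟩
    (flipMove G (inject₁ l) · bar G (inject₁ l)) (inject₁ p)
      ≡⟨ flipMove-· G (inject₁ l) (bar G (inject₁ l)) (inject₁ p) ⟩
    bar G (inject₁ l) (inject₁ p) xor (adj G (inject₁ p) (inject₁ l) ∧ bar G (inject₁ l) (inject₁ l))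
      ≡⟨ cong₂ _xor_ (previous p) (cong₂ _∧_ (adj-path p l) (previous l)) ⟩
    pathRoot k (toℕ p) xor (consecutive (toℕ p) (toℕ l) ∧ pathRoot k (toℕ l))
      ≡⟨ cong (λ i → pathRoot k (toℕ p) xor (consecutive (toℕ p) i ∧ pathRoot k i)) toℕl≡k ⟩
    pathRoot k (toℕ p) xor (consecutive (toℕ p) k ∧ pathRoot k k)
      ≡⟨ cong (λ x → pathRoot k (toℕ p) xor (consecutive (toℕ p) k ∧ x)) (pathRoot-self k) ⟩
    pathRoot k (toℕ p) xor (consecutive (toℕ p) k ∧ true)
      ≡⟨ cong (pathRoot k (toℕ p) xor_) (∧-identityʳ _) ⟩
    pathRoot k (toℕ p) xor consecutive (toℕ p) k
      ≡⟨ sym (pathRoot-suc k (toℕ p)) ⟩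
    pathRoot (suc k) (toℕ p)
      ∎
    where
    toℕl≡k : toℕ l ≡ k
    toℕl≡k = suc-injective l≡k
    previous : ∀ p → bar G (inject₁ l) (inject₁ p) ≡ pathRoot k (toℕ p)
    previous = bar-path k (inject₁ l) (trans (toℕ-inject₁ l) toℕl≡k)

  bar-support : ∀ l j → bar G l (inject₁ j) ≡ true → l ≡ inject₁ j ⊎ l ≡ suc j
  bar-support l j h =
    Sum.map (λ j≡l → toℕ-injective (trans (sym j≡l) (sym (toℕ-inject₁ j))))
            (λ j+1≡l → toℕ-injective (sym j+1≡l))
            (pathRoot-sound (toℕ l) (toℕ j) (trans (sym (bar-path _ l refl j)) h))

lemma3p5 : (m : ℕ) (G : SimpleGraph (suc (suc m)))
    → (∀ (a b : Fin (suc m)) → (adj G (inject₁ a) (inject₁ b) ≡ true)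
         → (toℕ a ≡ suc (toℕ b) ⊎ toℕ b ≡ suc (toℕ a)))
    → (∀ (a b : Fin (suc m)) → (toℕ a ≡ suc (toℕ b) ⊎ toℕ b ≡ suc (toℕ a))
         → adj G (inject₁ a) (inject₁ b) ≡ true)
    → Σ (Fin (suc m)) (λ j → adj G (fromℕ (suc m)) (inject₁ j) ≡ true)
    → (j : Fin (suc m))
    → ((flipMove G (inject₁ j) · bar G (inject₁ j)) ≈ bar G (suc j))
      × ((flipMove G (inject₁ j) · bar G (suc j)) ≈ bar G (inject₁ j))
      × (∀ (l : Fin (suc (suc m))) → ¬ (bar G l ≈ bar G (inject₁ j))
           → ¬ (bar G l ≈ bar G (suc j))
           → (flipMove G (inject₁ j) · bar G l) ≈ bar G l)
lemma3p5 m G adj⇒consecutive consecutive⇒adj _ j = raises , lowers , fixes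
  where
  open InducedPath G adj⇒consecutive consecutive⇒adj
  s : Fin (suc (suc m))
  s = inject₁ j

  raises : (flipMove G s · bar G s) ≈ bar G (suc j)
  raises = cong-app (sym (bar-suc G j))

  lowers : (flipMove G s · bar G (suc j)) ≈ bar G s
  lowers a = trans (cong (λ v → (flipMove G s · v) a) (bar-suc G j))
                   (flipMove-involutive G s (bar G s) a)

  fixes : ∀ l → ¬ (bar G l ≈ bar G s) → ¬ (bar G l ≈ bar G (suc j)) → (flipMove G s · bar G l) ≈ bar G l
  fixes l l≉j l≉j+1 = flipMove-fixes G s (bar G l) (¬-not (λ h →
    [ l≉j ∘ cong-app ∘ cong (bar G) , l≉j+1 ∘ cong-app ∘ cong (bar G) ] (bar-support l j h)))
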